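{- Let $X$ be a set and let $F,F'$ be nonempty forests in $\mathcal{F}(X)$. Then in $T(\mathrm{Mag}(X))$, $F*F'=\sum_{S\in\mathrm{supp}(\mathcal{M}(F'))}(-1)^{l(S)+l(F')}\,m_{\mathcal{M}(F')}(S)\;F\curvearrowleft S.$
   Context: $\mathrm{T}(X)$: planar rooted binary trees (including the one-leaf tree $|$) with leaves decorated by $X$; $T_1\vee T_2$: graft $T_1$ left and $T_2$ right on a new root. $\mathcal{F}(X)$: planar forests $T_1\cdots T_k$ of such trees; $l(T_1\cdots T_k)=k$. $\mathrm{Mag}(X)=\mathbb{K}\mathrm{T}(X)$ with $T_1*T_2=T_1\vee T_2$; $T(\mathrm{Mag}(X))$ = span of forests, concatenation product, coproduct making trees primitive, and $*$ extended canonically: for a vector space $V$ with bilinear $*$, the unique extension to $T(V)$ with, for all $f,g,h\in T(V)$, $y\in V$: $\varepsilon(f*g)=\varepsilon(f)\varepsilon(g)$; $\Delta(f*g)=\Delta(f)*\Delta(g)$; $f*1=f$; $1*f=\varepsilon(f)1$; $f*(gy)=(f*g)*y-f*(g*y)$; $(fg)*h=(f*h^{(1)})(g*h^{(2)})$; $(f*g)*h=f*((g*h^{(1)})h^{(2)})$. For forests $F=F_1\cdots F_k$ ($k\ge1$) and $S=S_1\cdots S_n$ ($n\ge1$) define $F\curvearrowleft S$ by induction on $n$: if $n=1$, $F\curvearrowleft S=\sum_{i=1}^k F_1\cdots(F_i\vee S)\cdots F_k$; otherwise $F\curvearrowleft S=(F\curvearrowleft S_1\cdots S_{n-1})*S_n$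 (extended linearly in $F$). A multiset is a pair $(E,m)$ with $m:E\to\mathbb{N}$ (multiplicity); its support is $m^{ -1}(\mathbb{N}\setminus\{0\})$; union of multisets adds multiplicities. Define a multiset $\mathcal{M}(T_1\cdots T_k)$ of forests recursively: $\mathcal{M}(T_1)=\{\{T_1\}\}$, and $\mathcal{M}(T_1\cdots T_kT_{k+1})$ is the multiset union of (a) the multiset containing $ST_{k+1}$ with multiplicity $m_{\mathcal{M}(T_1\cdots T_k)}(S)$ for each $S$ in the support of $\mathcal{M}(T_1\cdots T_k)$, and (b) the multisets $\mathcal{M}(T_1\cdots(T_i\vee T_{k+1})\cdots T_k)$ for $i=1,\dots,k$. $m_{\mathcal{M}(F')}(S)$ denotes the multiplicity of $S$ in $\mathcal{M}(F')$. -}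

module Defs where

open import Level using (_⊔_)
open import Data.Nat using (ℕ; zero; suc) renaming (_+_ to _+ℕ_)
open import Data.List using (List; []; _∷_; _++_; map; concatMap; length; [_])
open import Data.Maybe using (Maybe; nothing; just)
open import Data.Product using (_×_; _,_)
open import Algebra.Bundles using (CommutativeRing)

-- Planar rooted binary trees with leaves decorated by X.
-- (leaf x) is the one-leaf tree | decorated by x; (T₁ ∨ T₂) grafts T₁ left, T₂ right.
infixr 6 _∨_
data Tree (X : Set) : Set where
  leaf : X → Tree X
  _∨_  : Tree X → Tree X → Tree X

-- Planar forests T₁ ⋯ Tₖ (the empty forest is the unit 1 of T(Mag(X))).
Forest : Set → Set
Forest X = List (Tree X)

l : {X : Set} → Forest X → ℕ
l = length

unsnoc : {A : Set} → List A → Maybe (List A × A)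
unsnoc [] = nothing
unsnoc (x ∷ xs) with unsnoc xs
... | nothing = just ([] , x)
... | just (ys , y) = just (x ∷ ys , y)

graftAll : {X : Set} → Forest X → Tree X → List (Forest X)
graftAll [] y = []
graftAll (T ∷ f) y = ((T ∨ y) ∷ f) ∷ map (T ∷_) (graftAll f y)

-- The multiset 𝓜(F), represented as a list of forests (multiplicity = number
-- of occurrences).  Fuel-driven recursion; fuel = l(F) suffices.
-- (𝓜 of the empty forest is not defined in the paper; here it is the empty list.)
𝓜-fuel : {X : Set} → ℕ → Forest X → List (Forest X)
𝓜-fuel n F with unsnoc F
... | nothing = []
... | just ([] , T) = [ [ T ] ]
𝓜-fuel zero F | just (_ ∷ _ , T) = []
𝓜-fuel (suc n) F | just (g@(_ ∷ _) , T) =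
  map (λ S → S ++ [ T ]) (𝓜-fuel n g) ++ concatMap (𝓜-fuel n) (graftAll g T)

𝓜 : {X : Set} → Forest X → List (Forest X)
𝓜 F = 𝓜-fuel (length F) F

module _ {c ℓ} (R : CommutativeRing c ℓ) {X : Set} where
  open CommutativeRing R

  -- Elements of T(Mag(X)) over R: finite formal R-linear combinations of forests.
  Lin : Set c
  Lin = List (Carrier × Forest X)

  -- Equality in the free R-module on forests: the congruence generated by
  -- reordering, merging equal basis elements, dropping zero coefficients.
  infix 4 _≋_
  data _≋_ : Lin → Lin → Set (c ⊔ ℓ) where
    ≋-refl  : ∀ {u} → u ≋ u
    ≋-sym   : ∀ {u v} → u ≋ v → v ≋ u
    ≋-trans : ∀ {u v w} → u ≋ v → v ≋ w → u ≋ w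
    ≋-cons  : ∀ {a b S u v} → a ≈ b → u ≋ v → (a , S) ∷ u ≋ (b , S) ∷ v
    ≋-swap  : ∀ {x y u} → x ∷ y ∷ u ≋ y ∷ x ∷ u
    ≋-merge : ∀ {a b S u} → (a , S) ∷ (b , S) ∷ u ≋ (a + b , S) ∷ u
    ≋-zero  : ∀ {S u} → (0# , S) ∷ u ≋ u

  scale : Carrier → Lin → Lin
  scale k = map (λ { (a , h) → (k * a , h) })

  neg : Lin → Lin
  neg = map (λ { (a , h) → (- a , h) })

  -- forest * tree = Σᵢ F₁⋯(Fᵢ ∨ y)⋯Fₖ  (and 1 * y = 0), extended linearly
  graftLin : Lin → Tree X → Lin
  graftLin L y = concatMap (λ { (a , h) → map (λ h' → (a , h')) (graftAll h y) }) L

  -- The canonical extension * on T(Mag(X)) computed on basis forests f * g,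
  -- via the defining rules  f*1 = f,  1*g = ε(g)1,  f*(g y) = (f*g)*y - f*(g*y).
  star-fuel : ℕ → Forest X → Forest X → Lin
  star-fuel n f g with unsnoc g
  ... | nothing = [ (1# , f) ]
  star-fuel n [] g | just _ = []
  star-fuel zero (_ ∷ _) g | just _ = []
  star-fuel (suc n) f@(_ ∷ _) g | just (g₀ , y) =
    graftLin (star-fuel n f g₀) y
      ++ neg (concatMap (λ g' → star-fuel n f g') (graftAll g₀ y))

  star : Forest X → Forest X → Lin
  star f g = star-fuel (length g) f g

  starLin : Lin → Forest X → Lin
  starLin L g = concatMap (λ { (a , h) → scale a (star h g) }) L

  -- F ↶ S: for S = S₁, Σᵢ F₁⋯(Fᵢ ∨ S₁)⋯Fₖ ; otherwise (F ↶ S₁⋯Sₙ₋₁) * Sₙ.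
  -- (Only defined in the paper for nonempty S; here F ↶ 1 is set to 0.)
  arrowGo : Lin → Forest X → Lin
  arrowGo L [] = L
  arrowGo L (y ∷ ys) = arrowGo (starLin L [ y ]) ys

  _↶_ : Forest X → Forest X → Lin
  F ↶ [] = []
  F ↶ (S₁ ∷ Ss) = arrowGo (map (λ h → (1# , h)) (graftAll F S₁)) Ss

  sgn : ℕ → Carrier
  sgn zero = 1#
  sgn (suc n) = - sgn n

  rhs : Forest X → Forest X → Lin
  rhs F F' = concatMap (λ S → scale (sgn (l S +ℕ l F')) (F ↶ S)) (𝓜 F')

-- Induction on l(F'), peeling off its last tree: F' = g y.  The defining rule
-- F * (g y) = (F * g) * y - F * (g * y), where g * y is the sum of the forests
-- g' obtained by grafting y onto a tree of g, has the same shape as the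
-- recursion 𝓜(g y) = {S y : S ∈ 𝓜(g)} ∪ ⋃_{g'} 𝓜(g').  On the first part,
-- F ↶ (S y) = (F ↶ S) * y and l(S y) + l(g y) ≡ l(S) + l(g) (mod 2).  On the
-- second, each g' has length l(g) = l(g y) - 1, so the sign flips and absorbs
-- the minus.
module Submission where

open import Defs
open import Data.List using ([])
open import Relation.Binary.PropositionalEquality using (_≢_)
open import Algebra.Bundles using (CommutativeRing)

open import Data.Nat using (ℕ; zero; suc) renaming (_+_ to _+ℕ_)
open import Data.Nat.Properties using (+-comm; +-suc; suc-injective)
open import Data.List using (List; _∷_; _++_; _∷ʳ_; [_]; map; concatMap; length; _∷ʳ′_; initLast)
open import Data.List.Properties using (length-++; ++-assoc; ++-identityʳ; ++-conicalʳ; map-++; concatMap-++; concatMap-map; map-concatMap)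
open import Data.List.Relation.Unary.All using (All; []; _∷_; universal)
import Data.List.Relation.Unary.All.Properties as All
open import Data.List.Relation.Binary.Permutation.Propositional using (_↭_; refl; prep; swap; trans)
open import Data.List.Relation.Binary.Permutation.Propositional.Properties using (shifts)
open import Data.Maybe using (nothing; just)
open import Data.Product using (_,_)
open import Data.Empty using (⊥-elim)
open import Function using (_∘_)
open import Level using (_⊔_)
open import Relation.Binary.Bundles using (Setoid)
open import Relation.Binary.PropositionalEquality as ≡ using (_≡_; cong)
import Relation.Binary.Reasoning.Setoid as SetoidReasoning
import Algebra.Properties.Ring as RingProperties

length-∷ʳ : ∀ {a} {A : Set a} (xs : List A) (x : A) → length (xs ∷ʳ x) ≡ suc (length xs)
length-∷ʳ xs x = ≡.trans (length-++ xs) (+-comm (length xs) 1)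

∷ʳ≢[] : ∀ {a} {A : Set a} (x : A) (xs : List A) → xs ∷ʳ x ≢ []
∷ʳ≢[] x xs eq with ++-conicalʳ xs [ x ] eq
... | ()

concatMap-concatMap : ∀ {a b c} {A : Set a} {B : Set b} {C : Set c}
  (h : B → List C) (f : A → List B) (xs : List A) →
  concatMap h (concatMap f xs) ≡ concatMap (concatMap h ∘ f) xs
concatMap-concatMap h f [] = ≡.refl
concatMap-concatMap h f (x ∷ xs) =
  ≡.trans (concatMap-++ h (f x) (concatMap f xs)) (cong (concatMap h (f x) ++_) (concatMap-concatMap h f xs))

unsnoc-∷ʳ : {A : Set} (xs : List A) (x : A) → unsnoc (xs ∷ʳ x) ≡ just (xs , x)
unsnoc-∷ʳ [] x = ≡.refl
unsnoc-∷ʳ (y ∷ xs) x rewrite unsnoc-∷ʳ xs x = ≡.refl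

module _ {X : Set} where

  graftAll-length : (g : Forest X) (y : Tree X) → All (λ g' → length g' ≡ length g) (graftAll g y)
  graftAll-length [] y = []
  graftAll-length (T ∷ f) y = ≡.refl ∷ All.gmap⁺ (cong suc) (graftAll-length f y)

  𝓜-fuel-∷ʳ : ∀ n (T₀ : Tree X) (g : Forest X) (T : Tree X) →
    𝓜-fuel (suc n) (T₀ ∷ g ∷ʳ T)
      ≡ map (_∷ʳ T) (𝓜-fuel n (T₀ ∷ g)) ++ concatMap (𝓜-fuel n) (graftAll (T₀ ∷ g) T)
  𝓜-fuel-∷ʳ n T₀ g T rewrite unsnoc-∷ʳ (T₀ ∷ g) T = ≡.refl

  -- Needed because F ↶ 1 is set to 0, so F ↶ (S y) = (F ↶ S) * y holds only for S ≠ 1.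
  𝓜-fuel-nonempty : ∀ n (g : Forest X) → All (_≢ []) (𝓜-fuel n g)
  𝓜-fuel-nonempty n g with unsnoc g
  ... | nothing = []
  ... | just ([] , T) = (λ ()) ∷ []
  𝓜-fuel-nonempty zero g | just (_ ∷ _ , T) = []
  𝓜-fuel-nonempty (suc n) g | just (g₀@(_ ∷ _) , T) =
    All.++⁺ (All.map⁺ (universal (∷ʳ≢[] T) (𝓜-fuel n g₀)))
            (All.concat⁺ (All.map⁺ (universal (𝓜-fuel-nonempty n) (graftAll g₀ T))))

module _ {c ℓ} (R : CommutativeRing c ℓ) {X : Set} where
  open CommutativeRing R
    using (_≈_; _+_; _*_; -_; 0#; 1#; ring; reflexive;
           *-congˡ; *-congʳ; *-assoc; *-identityˡ; *-identityʳ; zeroˡ; zeroʳ; distribˡ; distribʳ)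
    renaming (refl to ≈-refl; sym to ≈-sym; trans to ≈-trans)
  open RingProperties ring using (-1*x≈-x; -‿involutive; -‿distribˡ-*)

  infix 4 _≈ᴸ_
  _≈ᴸ_ : Lin R {X} → Lin R {X} → Set (c ⊔ ℓ)
  _≈ᴸ_ = _≋_ R

  ≈ᴸ-setoid : Setoid c (c ⊔ ℓ)
  ≈ᴸ-setoid = record
    { Carrier = Lin R {X}
    ; _≈_ = _≈ᴸ_
    ; isEquivalence = record { refl = ≋-refl ; sym = ≋-sym ; trans = ≋-trans }
    }

  open SetoidReasoning ≈ᴸ-setoid

  ↭⇒≈ᴸ : ∀ {u v} → u ↭ v → u ≈ᴸ v
  ↭⇒≈ᴸ refl = ≋-refl
  ↭⇒≈ᴸ (prep x p) = ≋-cons ≈-refl (↭⇒≈ᴸ p)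
  ↭⇒≈ᴸ (swap x y p) = ≋-trans ≋-swap (≋-cons ≈-refl (≋-cons ≈-refl (↭⇒≈ᴸ p)))
  ↭⇒≈ᴸ (trans p q) = ≋-trans (↭⇒≈ᴸ p) (↭⇒≈ᴸ q)

  ++-congˡ : ∀ {u u'} v → u ≈ᴸ u' → u ++ v ≈ᴸ u' ++ v
  ++-congˡ v ≋-refl = ≋-refl
  ++-congˡ v (≋-sym p) = ≋-sym (++-congˡ v p)
  ++-congˡ v (≋-trans p q) = ≋-trans (++-congˡ v p) (++-congˡ v q)
  ++-congˡ v (≋-cons a≈b p) = ≋-cons a≈b (++-congˡ v p)
  ++-congˡ v ≋-swap = ≋-swap
  ++-congˡ v ≋-merge = ≋-merge
  ++-congˡ v ≋-zero = ≋-zero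

  ++-congʳ : ∀ u {v v'} → v ≈ᴸ v' → u ++ v ≈ᴸ u ++ v'
  ++-congʳ [] p = p
  ++-congʳ (x ∷ u) p = ≋-cons ≈-refl (++-congʳ u p)

  ++-cong : ∀ {u u' v v'} → u ≈ᴸ u' → v ≈ᴸ v' → u ++ v ≈ᴸ u' ++ v'
  ++-cong {u' = u'} {v} p q = ≋-trans (++-congˡ v p) (++-congʳ u' q)

  concatMap-cong : {A : Set} {f g : A → Lin R {X}} →
    (∀ x → f x ≈ᴸ g x) → ∀ xs → concatMap f xs ≈ᴸ concatMap g xs
  concatMap-cong f≈g [] = ≋-refl
  concatMap-cong f≈g (x ∷ xs) = ++-cong (f≈g x) (concatMap-cong f≈g xs)

  concatMap-cong-All : {A : Set} {P : A → Set} {f g : A → Lin R {X}} →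
    (∀ x → P x → f x ≈ᴸ g x) → ∀ {xs} → All P xs → concatMap f xs ≈ᴸ concatMap g xs
  concatMap-cong-All f≈g [] = ≋-refl
  concatMap-cong-All f≈g (px ∷ pxs) = ++-cong (f≈g _ px) (concatMap-cong-All f≈g pxs)

  scale-cong : ∀ k {u v} → u ≈ᴸ v → scale R k u ≈ᴸ scale R k v
  scale-cong k ≋-refl = ≋-refl
  scale-cong k (≋-sym p) = ≋-sym (scale-cong k p)
  scale-cong k (≋-trans p q) = ≋-trans (scale-cong k p) (scale-cong k q)
  scale-cong k (≋-cons a≈b p) = ≋-cons (*-congˡ a≈b) (scale-cong k p)
  scale-cong k ≋-swap = ≋-swap
  scale-cong k ≋-merge = ≋-trans ≋-merge (≋-cons (≈-sym (distribˡ k _ _)) ≋-refl)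
  scale-cong k ≋-zero = ≋-trans (≋-cons (zeroʳ k) ≋-refl) ≋-zero

  scale-congˡ : ∀ {a b} → a ≈ b → (u : Lin R {X}) → scale R a u ≈ᴸ scale R b u
  scale-congˡ a≈b [] = ≋-refl
  scale-congˡ a≈b (x ∷ u) = ≋-cons (*-congʳ a≈b) (scale-congˡ a≈b u)

  scale-identityˡ : (u : Lin R {X}) → scale R 1# u ≈ᴸ u
  scale-identityˡ [] = ≋-refl
  scale-identityˡ (x ∷ u) = ≋-cons (*-identityˡ _) (scale-identityˡ u)

  scale-zeroˡ : (u : Lin R {X}) → scale R 0# u ≈ᴸ []
  scale-zeroˡ [] = ≋-refl
  scale-zeroˡ (x ∷ u) = ≋-trans (≋-cons (zeroˡ _) ≋-refl) (≋-trans ≋-zero (scale-zeroˡ u))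

  scale-assoc : ∀ a b (u : Lin R {X}) → scale R a (scale R b u) ≈ᴸ scale R (a * b) u
  scale-assoc a b [] = ≋-refl
  scale-assoc a b (x ∷ u) = ≋-cons (≈-sym (*-assoc a b _)) (scale-assoc a b u)

  scale-distribʳ : ∀ a b (u : Lin R {X}) → scale R (a + b) u ≈ᴸ scale R a u ++ scale R b u
  scale-distribʳ a b [] = ≋-refl
  scale-distribʳ a b ((x , S) ∷ u) = begin
    ((a + b) * x , S) ∷ scale R (a + b) u            ≈⟨ ≋-cons (distribʳ x a b) (scale-distribʳ a b u) ⟩
    (a * x + b * x , S) ∷ scale R a u ++ scale R b u ≈⟨ ≋-sym ≋-merge ⟩
    (a * x , S) ∷ (b * x , S) ∷ scale R a u ++ scale R b u
      ≈⟨ ≋-cons ≈-refl (↭⇒≈ᴸ (shifts [ (b * x , S) ] (scale R a u))) ⟩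
    (a * x , S) ∷ scale R a u ++ (b * x , S) ∷ scale R b u ∎

  neg≈ᴸscale : (u : Lin R {X}) → neg R u ≈ᴸ scale R (- 1#) u
  neg≈ᴸscale [] = ≋-refl
  neg≈ᴸscale (x ∷ u) = ≋-cons (≈-sym (-1*x≈-x _)) (neg≈ᴸscale u)

  neg-cong : ∀ {u v} → u ≈ᴸ v → neg R u ≈ᴸ neg R v
  neg-cong {u} {v} p = ≋-trans (neg≈ᴸscale u) (≋-trans (scale-cong (- 1#) p) (≋-sym (neg≈ᴸscale v)))

  neg-scale : ∀ a (u : Lin R {X}) → neg R (scale R a u) ≈ᴸ scale R (- a) u
  neg-scale a [] = ≋-refl
  neg-scale a (x ∷ u) = ≋-cons (-‿distribˡ-* a _) (neg-scale a u)

  scale-map-1# : ∀ a (G : List (Forest X)) → scale R a (map (λ h → (1# , h)) G) ≈ᴸ map (λ h → (a , h)) G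
  scale-map-1# a [] = ≋-refl
  scale-map-1# a (h ∷ G) = ≋-cons (*-identityʳ a) (scale-map-1# a G)

  star-fuel-∷ʳ : ∀ n (T₀ : Tree X) (f g : Forest X) (y : Tree X) →
    star-fuel R (suc n) (T₀ ∷ f) (g ∷ʳ y)
      ≡ graftLin R (star-fuel R n (T₀ ∷ f) g) y ++ neg R (concatMap (star-fuel R n (T₀ ∷ f)) (graftAll g y))
  star-fuel-∷ʳ n T₀ f g y rewrite unsnoc-∷ʳ g y = ≡.refl

  star-tree : (f : Forest X) (y : Tree X) → star R f [ y ] ≡ map (λ h → (1# , h)) (graftAll f y)
  star-tree [] y = ≡.refl
  star-tree (T ∷ f) y = ≡.trans (++-identityʳ _) (++-identityʳ _)

  starLin-cong : ∀ {L L'} (g : Forest X) → L ≈ᴸ L' → starLin R L g ≈ᴸ starLin R L' g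
  starLin-cong g ≋-refl = ≋-refl
  starLin-cong g (≋-sym p) = ≋-sym (starLin-cong g p)
  starLin-cong g (≋-trans p q) = ≋-trans (starLin-cong g p) (starLin-cong g q)
  starLin-cong g (≋-cons {S = S} a≈b p) = ++-cong (scale-congˡ a≈b (star R S g)) (starLin-cong g p)
  starLin-cong g (≋-swap {x = a , S} {b , T} {L}) =
    ↭⇒≈ᴸ (shifts (scale R a (star R S g)) (scale R b (star R T g)))
  starLin-cong g (≋-merge {a} {b} {S} {L}) = begin
    scale R a (star R S g) ++ scale R b (star R S g) ++ starLin R L g
      ≡⟨ ++-assoc (scale R a (star R S g)) _ _ ⟨
    (scale R a (star R S g) ++ scale R b (star R S g)) ++ starLin R L g
      ≈⟨ ++-congˡ (starLin R L g) (scale-distribʳ a b (star R S g)) ⟨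
    scale R (a + b) (star R S g) ++ starLin R L g ∎
  starLin-cong g (≋-zero {S} {L}) = ++-congˡ (starLin R L g) (scale-zeroˡ (star R S g))

  starLin-scale : ∀ k (L : Lin R {X}) g → starLin R (scale R k L) g ≈ᴸ scale R k (starLin R L g)
  starLin-scale k [] g = ≋-refl
  starLin-scale k ((a , h) ∷ L) g = begin
    scale R (k * a) (star R h g) ++ starLin R (scale R k L) g
      ≈⟨ ++-cong (≋-sym (scale-assoc k a (star R h g))) (starLin-scale k L g) ⟩
    scale R k (scale R a (star R h g)) ++ scale R k (starLin R L g)
      ≡⟨ map-++ _ (scale R a (star R h g)) (starLin R L g) ⟨
    scale R k (scale R a (star R h g) ++ starLin R L g) ∎

  starLin-concatMap : {A : Set} (f : A → Lin R {X}) (xs : List A) (g : Forest X) →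
    starLin R (concatMap f xs) g ≡ concatMap (λ x → starLin R (f x) g) xs
  starLin-concatMap f xs g = concatMap-concatMap _ f xs

  graftLin≈ᴸstarLin : (L : Lin R {X}) (y : Tree X) → graftLin R L y ≈ᴸ starLin R L [ y ]
  graftLin≈ᴸstarLin [] y = ≋-refl
  graftLin≈ᴸstarLin ((a , f) ∷ L) y = ++-cong graft≈star (graftLin≈ᴸstarLin L y)
    where
    graft≈star : map (λ h → (a , h)) (graftAll f y) ≈ᴸ scale R a (star R f [ y ])
    graft≈star = begin
      map (λ h → (a , h)) (graftAll f y)              ≈⟨ scale-map-1# a (graftAll f y) ⟨
      scale R a (map (λ h → (1# , h)) (graftAll f y)) ≡⟨ cong (scale R a) (star-tree f y) ⟨
      scale R a (star R f [ y ])                      ∎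

  arrowGo-∷ʳ : (L : Lin R {X}) (S : Forest X) (y : Tree X) →
    arrowGo R L (S ∷ʳ y) ≡ starLin R (arrowGo R L S) [ y ]
  arrowGo-∷ʳ L [] y = ≡.refl
  arrowGo-∷ʳ L (T ∷ S) y = arrowGo-∷ʳ (starLin R L [ T ]) S y

  ↶-∷ʳ : (F : Forest X) (T : Tree X) (S : Forest X) (y : Tree X) →
    _↶_ R F (T ∷ S ∷ʳ y) ≡ starLin R (_↶_ R F (T ∷ S)) [ y ]
  ↶-∷ʳ F T S y = arrowGo-∷ʳ _ S y

  sgn-∷ʳ : ∀ (S : Forest X) y n → sgn R {X} (l (S ∷ʳ y) +ℕ suc n) ≈ sgn R {X} (l S +ℕ n)
  sgn-∷ʳ S y n = ≈-trans (reflexive (cong (sgn R) length-eq)) (-‿involutive (sgn R {X} (l S +ℕ n)))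
    where
    length-eq : l (S ∷ʳ y) +ℕ suc n ≡ suc (suc (l S +ℕ n))
    length-eq = ≡.trans (cong (_+ℕ suc n) (length-∷ʳ S y)) (cong suc (+-suc (l S) n))

  arrowTerm : Forest X → ℕ → Forest X → Lin R {X}
  arrowTerm F k S = scale R (sgn R {X} (l S +ℕ k)) (_↶_ R F S)

  arrowSum : Forest X → ℕ → List (Forest X) → Lin R {X}
  arrowSum F k = concatMap (arrowTerm F k)

  arrowTerm-∷ʳ : ∀ F n T S y →
    starLin R (arrowTerm F n (T ∷ S)) [ y ] ≈ᴸ arrowTerm F (suc n) (T ∷ S ∷ʳ y)
  arrowTerm-∷ʳ F n T S y = begin
    starLin R (scale R s (_↶_ R F (T ∷ S))) [ y ] ≈⟨ starLin-scale s (_↶_ R F (T ∷ S)) [ y ] ⟩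
    scale R s (starLin R (_↶_ R F (T ∷ S)) [ y ]) ≡⟨ cong (scale R s) (↶-∷ʳ F T S y) ⟨
    scale R s (_↶_ R F (T ∷ S ∷ʳ y))              ≈⟨ scale-congˡ (sgn-∷ʳ (T ∷ S) y n) _ ⟨
    arrowTerm F (suc n) (T ∷ S ∷ʳ y)              ∎
    where s = sgn R {X} (l (T ∷ S) +ℕ n)

  neg-arrowTerm : ∀ F n S → neg R (arrowTerm F n S) ≈ᴸ arrowTerm F (suc n) S
  neg-arrowTerm F n S = ≋-trans (neg-scale _ (_↶_ R F S))
    (scale-congˡ (reflexive (cong (sgn R) (≡.sym (+-suc (l S) n)))) (_↶_ R F S))

  arrowSum-∷ʳ : ∀ F n y {M} → All (_≢ []) M →
    starLin R (arrowSum F n M) [ y ] ≈ᴸ arrowSum F (suc n) (map (_∷ʳ y) M)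
  arrowSum-∷ʳ F n y {M} M≢[] = begin
    starLin R (arrowSum F n M) [ y ]
      ≡⟨ starLin-concatMap (arrowTerm F n) M [ y ] ⟩
    concatMap (λ S → starLin R (arrowTerm F n S) [ y ]) M
      ≈⟨ concatMap-cong-All append M≢[] ⟩
    concatMap (λ S → arrowTerm F (suc n) (S ∷ʳ y)) M
      ≡⟨ concatMap-map (arrowTerm F (suc n)) (_∷ʳ y) M ⟨
    arrowSum F (suc n) (map (_∷ʳ y) M) ∎
    where
    append : ∀ S → S ≢ [] → starLin R (arrowTerm F n S) [ y ] ≈ᴸ arrowTerm F (suc n) (S ∷ʳ y)
    append [] S≢[] = ⊥-elim (S≢[] ≡.refl)
    append (T ∷ S) _ = arrowTerm-∷ʳ F n T S y

  neg-arrowSum : ∀ F n M → neg R (arrowSum F n M) ≈ᴸ arrowSum F (suc n) M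
  neg-arrowSum F n M = begin
    neg R (arrowSum F n M)                       ≡⟨ map-concatMap _ (arrowTerm F n) M ⟩
    concatMap (λ S → neg R (arrowTerm F n S)) M ≈⟨ concatMap-cong (neg-arrowTerm F n) M ⟩
    arrowSum F (suc n) M                         ∎

  module _ (T₀ : Tree X) (f : Forest X) where

    star-fuel≈ᴸarrowSum : ∀ n g → length g ≡ suc n →
      star-fuel R (suc n) (T₀ ∷ f) g ≈ᴸ arrowSum (T₀ ∷ f) (suc n) (𝓜-fuel (suc n) g)
    star-fuel≈ᴸarrowSum-∷ʳ : ∀ n g y → length g ≡ n →
      star-fuel R (suc n) (T₀ ∷ f) (g ∷ʳ y) ≈ᴸ arrowSum (T₀ ∷ f) (suc n) (𝓜-fuel (suc n) (g ∷ʳ y))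

    star-fuel≈ᴸarrowSum n g len with initLast g
    star-fuel≈ᴸarrowSum n .[] () | []
    star-fuel≈ᴸarrowSum n .(g ∷ʳ y) len | g ∷ʳ′ y =
      star-fuel≈ᴸarrowSum-∷ʳ n g y (suc-injective (≡.trans (≡.sym (length-∷ʳ g y)) len))

    star-fuel≈ᴸarrowSum-∷ʳ zero [] y _ = begin
      star R F [ y ]                        ≡⟨ star-tree F y ⟩
      _↶_ R F [ y ]                         ≈⟨ scale-identityˡ (_↶_ R F [ y ]) ⟨
      scale R 1# (_↶_ R F [ y ])            ≈⟨ scale-congˡ (-‿involutive 1#) (_↶_ R F [ y ]) ⟨
      scale R (sgn R {X} 2) (_↶_ R F [ y ]) ≡⟨ ++-identityʳ _ ⟨
      arrowSum F 1 [ [ y ] ]                ∎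
      where F = T₀ ∷ f
    star-fuel≈ᴸarrowSum-∷ʳ (suc n) (T ∷ g) y len = begin
      star-fuel R (suc m) F (T ∷ g ∷ʳ y)
        ≡⟨ star-fuel-∷ʳ m T₀ f (T ∷ g) y ⟩
      graftLin R (star-fuel R m F (T ∷ g)) y ++ neg R (concatMap (star-fuel R m F) G)
        ≈⟨ ++-cong graft-part neg-part ⟩
      arrowSum F (suc m) (map (_∷ʳ y) M) ++ arrowSum F (suc m) (concatMap (𝓜-fuel m) G)
        ≡⟨ concatMap-++ (arrowTerm F (suc m)) (map (_∷ʳ y) M) (concatMap (𝓜-fuel m) G) ⟨
      arrowSum F (suc m) (map (_∷ʳ y) M ++ concatMap (𝓜-fuel m) G)
        ≡⟨ cong (arrowSum F (suc m)) (𝓜-fuel-∷ʳ m T g y) ⟨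
      arrowSum F (suc m) (𝓜-fuel (suc m) (T ∷ g ∷ʳ y)) ∎
      where
      F = T₀ ∷ f
      m = suc n
      M = 𝓜-fuel m (T ∷ g)
      G = graftAll (T ∷ g) y

      graft-part : graftLin R (star-fuel R m F (T ∷ g)) y ≈ᴸ arrowSum F (suc m) (map (_∷ʳ y) M)
      graft-part = begin
        graftLin R (star-fuel R m F (T ∷ g)) y    ≈⟨ graftLin≈ᴸstarLin (star-fuel R m F (T ∷ g)) y ⟩
        starLin R (star-fuel R m F (T ∷ g)) [ y ] ≈⟨ starLin-cong [ y ] (star-fuel≈ᴸarrowSum n (T ∷ g) len) ⟩
        starLin R (arrowSum F m M) [ y ]          ≈⟨ arrowSum-∷ʳ F m y (𝓜-fuel-nonempty m (T ∷ g)) ⟩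
        arrowSum F (suc m) (map (_∷ʳ y) M)        ∎

      neg-part : neg R (concatMap (star-fuel R m F) G) ≈ᴸ arrowSum F (suc m) (concatMap (𝓜-fuel m) G)
      neg-part = begin
        neg R (concatMap (star-fuel R m F) G)
          ≈⟨ neg-cong (concatMap-cong-All (λ g' len' → star-fuel≈ᴸarrowSum n g' (≡.trans len' len))
                                          (graftAll-length (T ∷ g) y)) ⟩
        neg R (concatMap (arrowSum F m ∘ 𝓜-fuel m) G)
          ≡⟨ cong (neg R) (concatMap-concatMap (arrowTerm F m) (𝓜-fuel m) G) ⟨
        neg R (arrowSum F m (concatMap (𝓜-fuel m) G))
          ≈⟨ neg-arrowSum F m (concatMap (𝓜-fuel m) G) ⟩
        arrowSum F (suc m) (concatMap (𝓜-fuel m) G) ∎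

mainTheorem16 : ∀ {c ℓ} (R : CommutativeRing c ℓ) {X : Set}
    (F F' : Forest X) → F ≢ [] → F' ≢ [] →
    _≋_ R (star R F F') (rhs R F F')
mainTheorem16 R [] F' F≢[] _ = ⊥-elim (F≢[] ≡.refl)
mainTheorem16 R F [] _ F'≢[] = ⊥-elim (F'≢[] ≡.refl)
-- rhs R F F' unfolds to arrowSum F (l F') (𝓜 F'), and star and 𝓜 both run on fuel l F'.
mainTheorem16 R (T₀ ∷ f) (T ∷ g) _ _ = star-fuel≈ᴸarrowSum R T₀ f (length g) (T ∷ g) ≡.refl
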